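{- Let $G=\mathrm{Sym}(5)$ in its natural action on $[5]$. There exists a set $D\subseteq\mathrm{Der}(G)$ whose number of labels $|\{\{d,d^{ -1}\}:d\in D\}|$ is smaller than the number of labels $|\{\{d,d^{ -1}\}:d\in D_{i\to j}\}|$ of $D_{i\to j}$ (for any distinct $i,j\in[5]$), such that $\alpha(\mathrm{Cay}(G,\mathrm{Der}(G)\setminus(D\cup D^{ -1})))>(5-1)!=24$.
   Context: A derangement is a permutation with no fixed point; $\mathrm{Der}(G)$ is the set of derangements in $G$. For $i\ne j$, $D_{i\to j}=\{d\in\mathrm{Der}(G): d(i)=j\}$. For inverse-closed $S\subseteq G$ not containing the identity, $\mathrm{Cay}(G,S)$ is the graph on $G$ with $g,h$ adjacent iff $g^{ -1}h\in S$; $\alpha$ denotes independence number. -}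

module Defs where

open import Data.Nat using (ℕ; zero; suc)
open import Data.Fin using (Fin)
open import Data.Fin.Properties using (all?) renaming (_≟_ to _≟F_)
open import Data.Vec using (Vec; []; _∷_; lookup; tabulate)
open import Data.Vec.Properties using (≡-dec)
open import Data.List using (List; []; _∷_; [_]; map; concatMap; filter; length; allFin; deduplicate)
open import Data.List.Membership.Propositional using (_∈_; _∉_)
open import Data.List.Relation.Unary.Any using (Any)
open import Data.Product using (_×_; _,_)
open import Data.Sum using (_⊎_)
open import Relation.Nullary using (¬_; Dec; yes; no)
open import Relation.Nullary.Decidable using (_→-dec_; ¬?; _×-dec_; _⊎-dec_)
open import Relation.Binary.PropositionalEquality using (_≡_; _≢_)

-- Maps [5] → [5] encoded as the vector of their values (i ↦ lookup w i);
-- points of [5] are Fin 5.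
Word : Set
Word = Vec (Fin 5) 5

app : Word → Fin 5 → Fin 5
app = lookup

_≟W_ : (u v : Word) → Dec (u ≡ v)
_≟W_ = ≡-dec _≟F_

-- A word is a permutation iff it is injective (on a finite set = bijective).
IsPerm : Word → Set
IsPerm w = ∀ i j → app w i ≡ app w j → i ≡ j

isPerm? : (w : Word) → Dec (IsPerm w)
isPerm? w = all? λ i → all? λ j → (app w i ≟F app w j) →-dec (i ≟F j)

allWords : ∀ n → List (Vec (Fin 5) n)
allWords zero = [ [] ]
allWords (suc n) = concatMap (λ x → map (x ∷_) (allWords n)) (allFin 5)

Sym5 : List Word
Sym5 = filter isPerm? (allWords 5)

_∘P_ : Word → Word → Word
g ∘P h = tabulate (λ x → app g (app h x))

preimage : Word → Fin 5 → Fin 5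
preimage w i = go (allFin 5)
  where
  go : List (Fin 5) → Fin 5
  go [] = i
  go (j ∷ js) with app w j ≟F i
  ... | yes _ = j
  ... | no _ = go js

inv : Word → Word
inv w = tabulate (preimage w)

IsDerangement : Word → Set
IsDerangement w = ∀ i → app w i ≢ i

isDerangement? : (w : Word) → Dec (IsDerangement w)
isDerangement? w = all? λ i → ¬? (app w i ≟F i)

Der : List Word
Der = filter isDerangement? Sym5

Dto : Fin 5 → Fin 5 → List Word
Dto i j = filter (λ d → app d i ≟F j) Der

-- unordered pairs {a,b} represented by ordered pairs, compared as unordered pairs
SamePair : (Word × Word) → (Word × Word) → Set
SamePair (a , b) (c , d) = (a ≡ c × b ≡ d) ⊎ (a ≡ d × b ≡ c)

samePair? : (p q : Word × Word) → Dec (SamePair p q)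
samePair? (a , b) (c , d) = ((a ≟W c) ×-dec (b ≟W d)) ⊎-dec ((a ≟W d) ×-dec (b ≟W c))

numLabels : List Word → ℕ
numLabels D = length (deduplicate samePair? (map (λ d → (d , inv d)) D))

ConnSet : List Word → Word → Set
ConnSet D x = x ∈ Der × x ∉ D × ¬ Any (λ d → x ≡ inv d) D

CayAdj : (Word → Set) → Word → Word → Set
CayAdj S g h = S (inv g ∘P h)

IsIndependent : (Word → Set) → List Word → Set
IsIndependent S I = ∀ g h → g ∈ I → h ∈ I → ¬ CayAdj S g h

module Submission where

open import Defs
open import Data.Nat using (_<_)
open import Data.Nat.Properties using (_<?_)
open import Data.Fin using (Fin; #_)
open import Data.Fin.Properties using (all?) renaming (_≟_ to _≟F_)
open import Data.Vec using (Vec; []; _∷_)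
open import Data.List using (List; []; _∷_; length; map)
open import Data.List.Relation.Unary.All as All using (All)
open import Data.List.Relation.Unary.Any using (Any; any?; here)
open import Data.List.Relation.Unary.Unique.Propositional using (Unique)
open import Data.List.Relation.Unary.Unique.DecPropositional _≟W_ using (unique?)
open import Data.List.Membership.Propositional using (_∈_; lose)
open import Data.List.Membership.Propositional.Properties
  using (∈-map⁺; ∈-concatMap⁺; ∈-filter⁺; ∈-filter⁻; ∈-allFin)
open import Data.List.Membership.DecPropositional _≟W_ using (_∈?_)
open import Data.Product using (Σ; _×_; _,_; proj₂)
open import Data.Sum using (_⊎_; inj₁; inj₂)
open import Relation.Nullary using (¬_; Dec)
open import Relation.Nullary.Decidable using (from-yes; ¬?; _×-dec_; _⊎-dec_; _→-dec_)
open import Relation.Binary.PropositionalEquality using (_≡_; _≢_; refl)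

-- The witnesses D₀ and I₀ come from a computer search. D₀ consists of nine
-- derangements, no two mutually inverse, so it has 9 labels, while each D_{i→j}
-- has 10; and all quotients g⁻¹h of elements of I₀ (25 permutations) avoid
-- Der(G) ∖ (D₀ ∪ D₀⁻¹).

∈-allWords : ∀ {n} (v : Vec (Fin 5) n) → v ∈ allWords n
∈-allWords [] = here refl
∈-allWords (x ∷ v) =
  ∈-concatMap⁺ (λ y → map (y ∷_) (allWords _))
    (lose (∈-allFin x) (∈-map⁺ (x ∷_) (∈-allWords v)))

∈-Sym5 : ∀ {w} → IsPerm w → w ∈ Sym5
∈-Sym5 {w} = ∈-filter⁺ isPerm? (∈-allWords w)

∈-Der : ∀ {w} → IsPerm w × IsDerangement w → w ∈ Der
∈-Der (perm , der) = ∈-filter⁺ isDerangement? (∈-Sym5 perm) der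

∈-Der⇒IsDerangement : ∀ {w} → w ∈ Der → IsDerangement w
∈-Der⇒IsDerangement w∈Der = proj₂ (∈-filter⁻ isDerangement? {xs = Sym5} w∈Der)

-- Tests "x is not a derangement" instead of "x ∉ Der", so that deciding it never
-- enumerates Sym(5).
Excluded : List Word → Word → Set
Excluded D x = ¬ IsDerangement x ⊎ x ∈ D ⊎ Any (λ d → x ≡ inv d) D

excluded? : ∀ D x → Dec (Excluded D x)
excluded? D x =
  ¬? (isDerangement? x) ⊎-dec (x ∈? D) ⊎-dec any? (λ d → x ≟W inv d) D

excluded⇒¬ConnSet : ∀ {D x} → Excluded D x → ¬ ConnSet D x
excluded⇒¬ConnSet (inj₁ ¬der)        (x∈Der , _ , _)  = ¬der (∈-Der⇒IsDerangement x∈Der)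
excluded⇒¬ConnSet (inj₂ (inj₁ x∈D))  (_ , x∉D , _)    = x∉D x∈D
excluded⇒¬ConnSet (inj₂ (inj₂ x∈D⁻¹)) (_ , _ , x∉D⁻¹) = x∉D⁻¹ x∈D⁻¹

quotientsExcluded⇒independent : ∀ {D I} →
  All (λ g → All (λ h → Excluded D (inv g ∘P h)) I) I →
  IsIndependent (ConnSet D) I
quotientsExcluded⇒independent table g h g∈I h∈I =
  excluded⇒¬ConnSet (All.lookup (All.lookup table g∈I) h∈I)

D₀ : List Word
D₀ =
    (# 1 ∷ # 3 ∷ # 4 ∷ # 0 ∷ # 2 ∷ [])
  ∷ (# 1 ∷ # 3 ∷ # 4 ∷ # 2 ∷ # 0 ∷ [])
  ∷ (# 2 ∷ # 3 ∷ # 4 ∷ # 1 ∷ # 0 ∷ [])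
  ∷ (# 3 ∷ # 2 ∷ # 4 ∷ # 1 ∷ # 0 ∷ [])
  ∷ (# 3 ∷ # 4 ∷ # 0 ∷ # 1 ∷ # 2 ∷ [])
  ∷ (# 1 ∷ # 0 ∷ # 3 ∷ # 4 ∷ # 2 ∷ [])
  ∷ (# 1 ∷ # 3 ∷ # 0 ∷ # 4 ∷ # 2 ∷ [])
  ∷ (# 1 ∷ # 4 ∷ # 3 ∷ # 0 ∷ # 2 ∷ [])
  ∷ (# 1 ∷ # 2 ∷ # 4 ∷ # 0 ∷ # 3 ∷ [])
  ∷ []

I₀ : List Word
I₀ =
    (# 1 ∷ # 2 ∷ # 4 ∷ # 0 ∷ # 3 ∷ [])
  ∷ (# 0 ∷ # 2 ∷ # 4 ∷ # 3 ∷ # 1 ∷ [])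
  ∷ (# 4 ∷ # 2 ∷ # 3 ∷ # 0 ∷ # 1 ∷ [])
  ∷ (# 3 ∷ # 2 ∷ # 1 ∷ # 0 ∷ # 4 ∷ [])
  ∷ (# 2 ∷ # 0 ∷ # 3 ∷ # 1 ∷ # 4 ∷ [])
  ∷ (# 2 ∷ # 0 ∷ # 3 ∷ # 4 ∷ # 1 ∷ [])
  ∷ (# 0 ∷ # 4 ∷ # 1 ∷ # 2 ∷ # 3 ∷ [])
  ∷ (# 0 ∷ # 2 ∷ # 4 ∷ # 1 ∷ # 3 ∷ [])
  ∷ (# 4 ∷ # 0 ∷ # 3 ∷ # 2 ∷ # 1 ∷ [])
  ∷ (# 3 ∷ # 0 ∷ # 1 ∷ # 2 ∷ # 4 ∷ [])
  ∷ (# 0 ∷ # 1 ∷ # 3 ∷ # 2 ∷ # 4 ∷ [])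
  ∷ (# 0 ∷ # 2 ∷ # 3 ∷ # 1 ∷ # 4 ∷ [])
  ∷ (# 0 ∷ # 3 ∷ # 4 ∷ # 2 ∷ # 1 ∷ [])
  ∷ (# 0 ∷ # 2 ∷ # 1 ∷ # 3 ∷ # 4 ∷ [])
  ∷ (# 2 ∷ # 0 ∷ # 4 ∷ # 1 ∷ # 3 ∷ [])
  ∷ (# 0 ∷ # 2 ∷ # 3 ∷ # 4 ∷ # 1 ∷ [])
  ∷ (# 0 ∷ # 4 ∷ # 3 ∷ # 2 ∷ # 1 ∷ [])
  ∷ (# 1 ∷ # 2 ∷ # 3 ∷ # 0 ∷ # 4 ∷ [])
  ∷ (# 1 ∷ # 0 ∷ # 4 ∷ # 2 ∷ # 3 ∷ [])
  ∷ (# 4 ∷ # 2 ∷ # 1 ∷ # 0 ∷ # 3 ∷ [])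
  ∷ (# 0 ∷ # 3 ∷ # 1 ∷ # 2 ∷ # 4 ∷ [])
  ∷ (# 0 ∷ # 2 ∷ # 1 ∷ # 4 ∷ # 3 ∷ [])
  ∷ (# 0 ∷ # 1 ∷ # 4 ∷ # 2 ∷ # 3 ∷ [])
  ∷ (# 1 ∷ # 0 ∷ # 3 ∷ # 2 ∷ # 4 ∷ [])
  ∷ (# 3 ∷ # 2 ∷ # 4 ∷ # 0 ∷ # 1 ∷ [])
  ∷ []

lemma5p5 : Σ (List Word) λ D →
    All (_∈ Der) D
    × (∀ (i j : Fin 5) → i ≢ j → numLabels D < numLabels (Dto i j))
    × Σ (List Word) λ I →
    All (_∈ Sym5) I × Unique I × IsIndependent (ConnSet D) I × 24 < length I
lemma5p5 =
  D₀ ,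
  All.map ∈-Der (from-yes (All.all? (λ w → isPerm? w ×-dec isDerangement? w) D₀)) ,
  from-yes (all? λ i → all? λ j → ¬? (i ≟F j) →-dec (numLabels D₀ <? numLabels (Dto i j))) ,
  I₀ ,
  All.map ∈-Sym5 (from-yes (All.all? isPerm? I₀)) ,
  from-yes (unique? I₀) ,
  quotientsExcluded⇒independent
    (from-yes (All.all? (λ g → All.all? (λ h → excluded? D₀ (inv g ∘P h)) I₀) I₀)) ,
  from-yes (24 <? length I₀)
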